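{- Let $r\geqslant 2$ and let $n_1\geqslant n_2\geqslant \cdots \geqslant n_r\geqslant 1$ be integers. Then $\chi_2(K_{n_1,n_2,\ldots,n_r})=n_1$.
   Context: All graphs are finite and simple. For a graph $G$, the distance $d(u,v)$ is the length of a shortest $(u,v)$-path. A mapping $f:V(G)\to\{1,\ldots,k\}$ is a 2-proper $k$-coloring of $G$ if $f(u)\neq f(v)$ whenever $d(u,v)=2$ (adjacent vertices may receive the same color). The 2-proper chromatic number $\chi_2(G)$ is the minimum $k$ such that $G$ has a 2-proper $k$-coloring. $K_{n_1,n_2,\ldots,n_r}$ denotes the complete $r$-partite graph whose vertex set is partitioned into $r$ disjoint parts of sizes $n_1,\ldots,n_r$, with two vertices adjacent if and only if they lie in different parts. -}

module Defs where

open import Data.Nat using (ℕ; zero; suc; _≤_; _<_)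
open import Data.Fin using (Fin)
open import Data.Product using (Σ; Σ-syntax; _×_; _,_)
open import Relation.Nullary using (¬_)
open import Relation.Binary.PropositionalEquality using (_≡_; _≢_)

record Graph (V : Set) : Set₁ where
  field
    Adj     : V → V → Set
    sym     : ∀ {u v} → Adj u v → Adj v u
    irrefl  : ∀ {u} → ¬ Adj u u
open Graph public

data Walk {V : Set} (G : Graph V) : V → V → ℕ → Set where
  here : ∀ {u} → Walk G u u zero
  step : ∀ {u w v k} → Adj G u w → Walk G w v k → Walk G u v (suc k)

Dist : {V : Set} → Graph V → V → V → ℕ → Set
Dist G u v k = Walk G u v k × (∀ m → m < k → ¬ Walk G u v m)

Is2Proper : {V : Set} (G : Graph V) {k : ℕ} → (V → Fin k) → Set
Is2Proper G f = ∀ u v → Dist G u v 2 → f u ≢ f v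

Chi2≡ : {V : Set} → Graph V → ℕ → Set
Chi2≡ {V} G k =
  (Σ[ f ∈ (V → Fin k) ] Is2Proper G f)
  × (∀ m → (f : V → Fin m) → Is2Proper G f → k ≤ m)

-- Complete r-partite graph K_{ns 0, ..., ns (r-1)}:
-- vertices are pairs (part i, index within part), adjacent iff in different parts.
KVertex : (r : ℕ) → (Fin r → ℕ) → Set
KVertex r ns = Σ[ i ∈ Fin r ] Fin (ns i)

CompleteMultipartite : (r : ℕ) (ns : Fin r → ℕ) → Graph (KVertex r ns)
CompleteMultipartite r ns = record
  { Adj    = λ { (i , _) (j , _) → i ≢ j }
  ; sym    = λ { ne eq → ne (Relation.Binary.PropositionalEquality.sym eq) }
  ; irrefl = λ { ne → ne Relation.Binary.PropositionalEquality.refl }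
  }

module Submission where

-- In the complete multipartite graph K = K_{n_1,...,n_r} two vertices are at
-- distance 2 exactly when they are distinct vertices of the same part (and some
-- other part is nonempty, so that they have a common neighbour).
--
--  * upper bound: colouring each vertex by its index inside its part is
--    2-proper, since vertices of different parts are never at distance 2 and
--    distinct vertices of one part get distinct indices; it uses max n_i = n_1
--    colours;
--  * lower bound: any 2-proper colouring is injective on a part that has a
--    vertex outside it, so it needs at least as many colours as that part has
--    vertices; applied to the largest part n_1 (the part r ≥ 2 provides a
--    common neighbour) this gives χ₂(K) ≥ n_1.

open import Defs
open import Data.Nat using (ℕ; suc; _≤_; _<_; z≤n; s≤s)
open import Data.Fin using (Fin; toℕ; inject≤; fromℕ<; _≟_) renaming (zero to fzero)
open import Data.Fin.Properties using (toℕ-inject≤; toℕ-injective; injective⇒≤; toℕ-fromℕ<)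
open import Data.Product using (Σ; _,_)
open import Relation.Binary.PropositionalEquality
  using (_≡_; _≢_; refl; cong; subst) renaming (sym to ≡-sym; trans to ≡-trans)
open import Relation.Nullary using (yes; no; ¬_)
open import Data.Empty using (⊥-elim)

module Multipartite (r : ℕ) (ns : Fin r → ℕ) where

  K : Graph (KVertex r ns)
  K = CompleteMultipartite r ns

  walk₀-endpoints : ∀ {u v} → Walk K u v 0 → u ≡ v
  walk₀-endpoints here = refl

  no-edge-within-part : ∀ {i a b} → ¬ Walk K (i , a) (i , b) 1
  no-edge-within-part (step adj here) = adj refl

  -- Vertices at distance 2 lie in the same part (vertices of different parts
  -- are adjacent) and are distinct (equal vertices are at distance 0).
  dist₂-same-part : ∀ {i j a b} → Dist K (i , a) (j , b) 2
    → Σ (i ≡ j) λ { refl → a ≢ b }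
  dist₂-same-part {i} {j} {a} (_ , shorter) with i ≟ j
  ... | no i≢j = ⊥-elim (shorter 1 (s≤s (s≤s z≤n)) (step i≢j here))
  ... | yes refl = refl , λ { refl → shorter 0 (s≤s z≤n) here }

  -- Conversely, two distinct vertices of part i are at distance 2 as soon as
  -- some other part j contains a vertex c, a common neighbour of both.
  dist₂-within-part : ∀ {i j a b} (c : Fin (ns j)) → i ≢ j → a ≢ b
    → Dist K (i , a) (i , b) 2
  dist₂-within-part c i≢j a≢b =
      step {w = _ , c} i≢j (step (λ j≡i → i≢j (≡-sym j≡i)) here)
    , shorter
    where
    shorter : ∀ m → m < 2 → ¬ Walk K _ _ m
    shorter 0 _ w with walk₀-endpoints w
    ... | refl = a≢b refl
    shorter 1 _ w = no-edge-within-part w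
    shorter (suc (suc _)) (s≤s (s≤s ())) _

  index-colouring : ∀ {N} → (∀ i → ns i ≤ N)
    → Σ (KVertex r ns → Fin N) (Is2Proper K)
  index-colouring {N} small = colour , proper
    where
    colour : KVertex r ns → Fin N
    colour (i , a) = inject≤ a (small i)

    proper : Is2Proper K colour
    proper (i , a) (j , b) d same-colour with dist₂-same-part d
    ... | refl , a≢b = a≢b (toℕ-injective same-index)
      where
      same-index : toℕ a ≡ toℕ b
      same-index = ≡-trans (≡-sym (toℕ-inject≤ a (small i)))
                    (≡-trans (cong toℕ same-colour) (toℕ-inject≤ b (small i)))

  -- Lower bound: a 2-proper m-colouring is injective on part i whenever some
  -- other part j is nonempty, so part i has at most m vertices.
  part-size≤colours : ∀ {m i j} → i ≢ j → Fin (ns j)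
    → (g : KVertex r ns → Fin m) → Is2Proper K g → ns i ≤ m
  part-size≤colours {i = i} i≢j c g proper = injective⇒≤ injective
    where
    injective : ∀ {a b} → g (i , a) ≡ g (i , b) → a ≡ b
    injective {a} {b} same-colour with a ≟ b
    ... | yes a≡b = a≡b
    ... | no a≢b = ⊥-elim (proper _ _ (dist₂-within-part c i≢j a≢b) same-colour)

inhabited : ∀ {n} → 1 ≤ n → Fin n
inhabited {suc _} _ = fzero

lemma2 : (r : ℕ) → 2 ≤ r → (ns : Fin r → ℕ)
    → (∀ (i j : Fin r) → toℕ i ≤ toℕ j → ns j ≤ ns i)
    → (∀ (i : Fin r) → 1 ≤ ns i)
    → (i₀ : Fin r) → toℕ i₀ ≡ 0
    → Chi2≡ (CompleteMultipartite r ns) (ns i₀)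
lemma2 r 2≤r ns decreasing positive i₀ i₀-first =
    index-colouring largest
  , λ m g proper → part-size≤colours i₀≢i₁ (inhabited (positive i₁)) g proper
  where
  open Multipartite r ns

  largest : ∀ i → ns i ≤ ns i₀
  largest i = decreasing i₀ i (subst (_≤ toℕ i) (≡-sym i₀-first) z≤n)

  i₁ : Fin r
  i₁ = fromℕ< 2≤r

  i₀≢i₁ : i₀ ≢ i₁
  i₀≢i₁ e with ≡-trans (≡-sym i₀-first) (≡-trans (cong toℕ e) (toℕ-fromℕ< 2≤r))
  ... | ()
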